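{- Let $B^+_r$ be an $r$-out-branching. If $B^+_r$ is winning, then it has a spanning out-galaxy, and hence a $(\delta^+\ge1,\delta^-\ge1)$-bipartite-partition. If $B^+_r$ is losing, then $B^+_r-r$ has a spanning out-galaxy, and hence a $(\delta^+\ge1,\delta^-\ge1)$-bipartite-partition.
   Context: An $r$-out-branching is a digraph in which $r$ has in-degree $0$, every other vertex has in-degree $1$, and every vertex is reachable from $r$ (a spanning out-tree rooted at $r$). A non-trivial out-star is a digraph on at least two vertices consisting of a root with arcs to all other vertices; an out-galaxy is a set of vertex-disjoint non-trivial out-stars, spanning if they cover all vertices. Consider the procedure: take a leaf $v$ of maximum depth, let $v'$ be its parent, remove the out-tree rooted at $v'$ (which is an out-star) from the branching, and repeat until either no vertex remains or only the root $r$ remains. $B^+_r$ is winning in the first case and losing in the second. A $(\delta^+\ge1,\delta^-\ge1)$-bipartite-partition of a digraph $D$ is a partition $(V_1,V_2)$ of $V(D)$ such that every vertex of $V_1$ has an out-neighbour in $V_2$ and every vertex of $V_2$ has an in-neighbour in $V_1$. -}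

module Defs where

open import Data.Nat using (ℕ; zero; suc; _≤_)
open import Data.Fin using (Fin)
open import Data.Product using (Σ; ∃; _×_; _,_)
open import Data.Sum using (_⊎_)
open import Data.Unit using (⊤)
open import Data.Empty using (⊥)
open import Data.List using (List; []; _∷_; concatMap)
open import Data.List.NonEmpty using (List⁺; toList)
open import Data.List.Relation.Unary.All using (All)
open import Data.List.Membership.Propositional using (_∈_)
open import Data.List.Relation.Unary.Unique.Propositional using (Unique)
open import Relation.Binary.PropositionalEquality using (_≡_; _≢_)
open import Relation.Binary.Construct.Closure.ReflexiveTransitive using (Star)
open import Relation.Nullary using (¬_)

Digraph : ℕ → Set₁
Digraph n = Fin n → Fin n → Set

VSet : ℕ → Set₁
VSet n = Fin n → Set

_⇔_ : Set → Set → Set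
P ⇔ Q = (P → Q) × (Q → P)

module _ {n : ℕ} where

  FullSet : VSet n
  FullSet _ = ⊤

  AllBut : Fin n → VSet n
  AllBut r v = v ≢ r

  ExactlyOneInNbr : Digraph n → Fin n → Set
  ExactlyOneInNbr A v = Σ (Fin n) λ u → A u v × (∀ w → A w v → w ≡ u)

  IsOutBranching : Digraph n → Fin n → Set
  IsOutBranching A r =
    (∀ u → ¬ A u r) × (∀ v → v ≢ r → ExactlyOneInNbr A v) × (∀ v → Star A r v)

  Induced : Digraph n → VSet n → Digraph n
  Induced A S u w = S u × S w × A u w

  data Walk (A : Digraph n) : Fin n → Fin n → ℕ → Set where
    here : ∀ {u} → Walk A u u zero
    step : ∀ {u w v k} → A u w → Walk A w v k → Walk A u v (suc k)

  IsLeaf : Digraph n → VSet n → Fin n → Set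
  IsLeaf A S v = S v × (∀ w → ¬ Induced A S v w)

  IsMaxDepthLeaf : Digraph n → Fin n → VSet n → Fin n → Set
  IsMaxDepthLeaf A r S v =
    IsLeaf A S v ×
    (∀ w → IsLeaf A S w → ∀ dv dw →
       Walk (Induced A S) r v dv → Walk (Induced A S) r w dw → dw ≤ dv)

  -- One step of the procedure: pick a maximum-depth leaf v with parent v',
  -- remove the out-tree rooted at v' (all vertices reachable from v' in B[S]).
  Step : Digraph n → Fin n → VSet n → VSet n → Set
  Step A r S S' =
    Σ (Fin n) λ v → Σ (Fin n) λ v' →
      IsMaxDepthLeaf A r S v × Induced A S v' v ×
      (∀ w → S' w ⇔ (S w × ¬ Star (Induced A S) v' w))

  IsEmpty : VSet n → Set
  IsEmpty S = ∀ w → ¬ S w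

  IsOnlyRoot : Fin n → VSet n → Set
  IsOnlyRoot r S = ∀ w → S w ⇔ (w ≡ r)

  Winning : Digraph n → Fin n → Set₁
  Winning A r = Σ (VSet n) λ S → Star (Step A r) FullSet S × IsEmpty S

  Losing : Digraph n → Fin n → Set₁
  Losing A r = Σ (VSet n) λ S → Star (Step A r) FullSet S × IsOnlyRoot r S

  OutStar : Set
  OutStar = Fin n × List⁺ (Fin n)

  starVerts : OutStar → List (Fin n)
  starVerts (c , ls) = c ∷ toList ls

  IsOutStarIn : Digraph n → OutStar → Set
  IsOutStarIn A (c , ls) = ∀ w → w ∈ toList ls → A c w

  SpanningOutGalaxy : Digraph n → VSet n → Set
  SpanningOutGalaxy A U =
    Σ (List OutStar) λ gs →
      All (IsOutStarIn A) gs ×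
      Unique (concatMap starVerts gs) ×
      (∀ v → U v ⇔ (v ∈ concatMap starVerts gs))

  BipartitePartition : Digraph n → VSet n → Set₁
  BipartitePartition A U =
    Σ (VSet n) λ V₁ → Σ (VSet n) λ V₂ →
      (∀ v → U v ⇔ (V₁ v ⊎ V₂ v)) ×
      (∀ v → V₁ v → V₂ v → ⊥) ×
      (∀ v → V₁ v → ∃ λ w → V₂ w × A v w) ×
      (∀ v → V₂ v → ∃ λ u → V₁ u × A u v)

module Submission where

-- The galaxy consists of exactly the out-stars removed by the procedure.  Each
-- step removes the out-tree at the parent v' of a deepest leaf v of the current
-- branching B[S]; a path v' → x → y would put y deeper than v, so this out-tree
-- is indeed a star.  Along a run S ⇝ T the removed stars are vertex-disjoint and
-- cover S ∖ T; a winning (losing) run starts at V and ends at ∅ (at {r}).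
--
-- Intermediate vertex sets are kept decidable, so that the children of v'
-- can be listed by filtering.

open import Defs
open import Function using (_∘_)
open import Data.Nat using (ℕ; zero; suc; _≤_; _<_; _+_; _∸_; s≤s; s≤s⁻¹; _≤?_; _<?_)
open import Data.Nat.Properties
  using (1+n≰n; <⇒≤; <⇒≱; ≮⇒≥; m≤n⇒m<n∨m≡n; m≤n+m; +-identityʳ; +-suc; m∸n+n≡m; +-monoʳ-<)
open import Data.Fin using (Fin; toℕ; _≟_)
open import Data.Fin.Properties using (pigeonhole; toℕ<n)
open import Data.Product using (∃; _×_; _,_; proj₁; proj₂)
open import Data.Sum using (_⊎_; inj₁; inj₂; [_,_]; map₂)
open import Data.Unit using (tt)
open import Data.Empty using (⊥; ⊥-elim)
open import Relation.Nullary using (¬_; Dec; yes; no)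
open import Relation.Nullary.Decidable using (¬?; _×-dec_; ¬¬-excluded-middle; decidable-stable)
open import Relation.Binary.PropositionalEquality using (_≡_; _≢_; refl; sym; trans; cong; subst; module ≡-Reasoning)
open import Relation.Binary.Construct.Closure.ReflexiveTransitive using (Star; ε; _◅_; _◅◅_)
  renaming (map to Star-map)
open import Data.List using (List; []; _∷_; _++_; filter; concatMap; allFin)
open import Data.List.NonEmpty using (toList) renaming (_∷_ to _∷⁺_)
open import Data.List.Relation.Unary.All as All using (All; []; _∷_)
open import Data.List.Relation.Unary.Any using (Any; here; there)
open import Data.List.Relation.Unary.AllPairs using ([]; _∷_)
open import Data.List.Membership.Propositional using (_∈_)
open import Data.List.Membership.Propositional.Properties
  using (∈-++⁺ˡ; ∈-++⁺ʳ; ∈-++⁻; ∈-filter⁺; ∈-filter⁻; ∈-allFin)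
open import Data.List.Relation.Unary.Unique.Propositional using (Unique)
open import Data.List.Relation.Unary.Unique.Propositional.Properties using (++⁺; filter⁺; allFin⁺)
open import Data.List.Relation.Binary.Disjoint.Propositional using (Disjoint)

unique-++⁻ : ∀ {X : Set} (xs : List X) {ys : List X} → Unique (xs ++ ys) → Disjoint xs ys × Unique ys
unique-++⁻ [] u = (λ { (() , _) }) , u
unique-++⁻ (x ∷ xs) (x∉ ∷ u) = disjoint , proj₂ (unique-++⁻ xs u)
  where
  disjoint : Disjoint (x ∷ xs) _
  disjoint (here refl , m) = All.lookup x∉ (∈-++⁺ʳ xs m) refl
  disjoint (there m , m′) = proj₁ (unique-++⁻ xs u) (m , m′)

module _ {n : ℕ} where

  _∖_ : VSet n → VSet n → VSet n
  (S ∖ T) v = S v × ¬ T v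

module Galaxies {n : ℕ} (A : Digraph n) where

  galaxy-resp : ∀ {U W : VSet n} → (∀ v → U v ⇔ W v) → SpanningOutGalaxy A U → SpanningOutGalaxy A W
  galaxy-resp U⇔W (gs , stars , unique , covers) =
    gs , stars , unique ,
    λ v → proj₁ (covers v) ∘ proj₂ (U⇔W v) , proj₁ (U⇔W v) ∘ proj₂ (covers v)

  galaxy-∅ : SpanningOutGalaxy A (λ _ → ⊥)
  galaxy-∅ = [] , [] , [] , λ v → ⊥-elim , λ ()

  galaxy-∷ : ∀ {U : VSet n} (s : OutStar) → IsOutStarIn A s → Unique (starVerts s) →
             (∀ v → v ∈ starVerts s → ¬ U v) → SpanningOutGalaxy A U →
             SpanningOutGalaxy A (λ v → v ∈ starVerts s ⊎ U v)
  galaxy-∷ s isStar uniqueₛ avoids (gs , stars , unique , covers) =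
    s ∷ gs , isStar ∷ stars ,
    ++⁺ uniqueₛ unique (λ (m , m′) → avoids _ m (proj₂ (covers _) m′)) ,
    λ v → [ ∈-++⁺ˡ , ∈-++⁺ʳ (starVerts s) ∘ proj₁ (covers v) ]
        , map₂ (proj₂ (covers v)) ∘ ∈-++⁻ (starVerts s)

  Centre Satellite : List OutStar → VSet n
  Centre gs v = Any (λ g → v ≡ proj₁ g) gs
  Satellite gs v = Any (λ g → v ∈ toList (proj₂ g)) gs

  vertex⇒centre⊎satellite : ∀ gs {v} → v ∈ concatMap starVerts gs → Centre gs v ⊎ Satellite gs v
  vertex⇒centre⊎satellite ((c , ls) ∷ gs) (here eq) = inj₁ (here eq)
  vertex⇒centre⊎satellite ((c , ls) ∷ gs) (there m) with ∈-++⁻ (toList ls) m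
  ... | inj₁ mₗ = inj₂ (here mₗ)
  ... | inj₂ mᵣ = [ inj₁ ∘ there , inj₂ ∘ there ] (vertex⇒centre⊎satellite gs mᵣ)

  centre⊎satellite⇒vertex : ∀ gs {v} → Centre gs v ⊎ Satellite gs v → v ∈ concatMap starVerts gs
  centre⊎satellite⇒vertex ((c , ls) ∷ gs) (inj₁ (here eq)) = here eq
  centre⊎satellite⇒vertex ((c , ls) ∷ gs) (inj₂ (here m)) = there (∈-++⁺ˡ m)
  centre⊎satellite⇒vertex ((c , ls) ∷ gs) (inj₁ (there x)) =
    there (∈-++⁺ʳ (toList ls) (centre⊎satellite⇒vertex gs (inj₁ x)))
  centre⊎satellite⇒vertex ((c , ls) ∷ gs) (inj₂ (there x)) =
    there (∈-++⁺ʳ (toList ls) (centre⊎satellite⇒vertex gs (inj₂ x)))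

  centre-not-satellite : ∀ gs {v} → Unique (concatMap starVerts gs) → Centre gs v → ¬ Satellite gs v
  centre-not-satellite ((c , ls) ∷ gs) (c∉ ∷ u) (here refl) (here m) =
    All.lookup c∉ (∈-++⁺ˡ m) refl
  centre-not-satellite ((c , ls) ∷ gs) (c∉ ∷ u) (here refl) (there y) =
    All.lookup c∉ (∈-++⁺ʳ (toList ls) (centre⊎satellite⇒vertex gs (inj₂ y))) refl
  centre-not-satellite ((c , ls) ∷ gs) (c∉ ∷ u) (there x) (here m) =
    proj₁ (unique-++⁻ (toList ls) u) (m , centre⊎satellite⇒vertex gs (inj₁ x))
  centre-not-satellite ((c , ls) ∷ gs) (c∉ ∷ u) (there x) (there y) =
    centre-not-satellite gs (proj₂ (unique-++⁻ (toList ls) u)) x y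

  centre⇒out-arc : ∀ gs {v} → All (IsOutStarIn A) gs → Centre gs v → ∃ λ w → Satellite gs w × A v w
  centre⇒out-arc ((c , (l ∷⁺ ls)) ∷ gs) (isStar ∷ _) (here refl) = l , here (here refl) , isStar l (here refl)
  centre⇒out-arc (g ∷ gs) (_ ∷ stars) (there x) with centre⇒out-arc gs stars x
  ... | w , y , a = w , there y , a

  satellite⇒in-arc : ∀ gs {v} → All (IsOutStarIn A) gs → Satellite gs v → ∃ λ u → Centre gs u × A u v
  satellite⇒in-arc ((c , ls) ∷ gs) (isStar ∷ _) (here m) = c , here refl , isStar _ m
  satellite⇒in-arc (g ∷ gs) (_ ∷ stars) (there y) with satellite⇒in-arc gs stars y
  ... | u , x , a = u , there x , a

  -- A spanning out-galaxy yields a (δ⁺≥1, δ⁻≥1)-bipartite-partition: (centres, satellites).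
  galaxy⇒bipartite : ∀ {U} → SpanningOutGalaxy A U → BipartitePartition A U
  galaxy⇒bipartite (gs , stars , unique , covers) =
    Centre gs , Satellite gs ,
    (λ v → vertex⇒centre⊎satellite gs ∘ proj₁ (covers v) , proj₂ (covers v) ∘ centre⊎satellite⇒vertex gs) ,
    (λ v → centre-not-satellite gs unique) ,
    (λ v → centre⇒out-arc gs stars) ,
    (λ v → satellite⇒in-arc gs stars)

module _ {n : ℕ} where

  walk-map : ∀ {R Q : Digraph n} → (∀ {a b} → R a b → Q a b) → ∀ {x y k} → Walk R x y k → Walk Q x y k
  walk-map f here = here
  walk-map f (step a w) = step (f a) (walk-map f w)

  star⇒walk : ∀ {R : Digraph n} {x y} → Star R x y → ∃ (Walk R x y)
  star⇒walk ε = 0 , here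
  star⇒walk (a ◅ s) with star⇒walk s
  ... | k , w = suc k , step a w

  walk-snoc : ∀ {R : Digraph n} {x y z k} → Walk R x y k → R y z → Walk R x z (suc k)
  walk-snoc here a = step a here
  walk-snoc (step a w) b = step a (walk-snoc w b)

  run-shrinks : ∀ {A : Digraph n} {r S T} → Star (Step A r) S T → ∀ w → T w → S w
  run-shrinks ε w Tw = Tw
  run-shrinks ((_ , _ , _ , _ , S′⇔) ◅ run) w Tw = proj₁ (proj₁ (S′⇔ w) (run-shrinks run w Tw))

module OutBranching {n : ℕ} (A : Digraph n) (r : Fin n) (branching : IsOutBranching A r) where

  private
    root-no-in : ∀ u → ¬ A u r
    root-no-in = proj₁ branching

    in-neighbour : ∀ v → v ≢ r → ExactlyOneInNbr A v
    in-neighbour = proj₁ (proj₂ branching)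

  -- The parent of a vertex; by convention the root is its own parent.
  parent : Fin n → Fin n
  parent v with v ≟ r
  ... | yes _ = r
  ... | no v≢r = proj₁ (in-neighbour v v≢r)

  arc⇒parent : ∀ {u w} → A u w → parent w ≡ u
  arc⇒parent {u} {w} a with w ≟ r
  ... | yes refl = ⊥-elim (root-no-in u a)
  ... | no w≢r = sym (proj₂ (proj₂ (in-neighbour w w≢r)) u a)

  arc? : ∀ u w → Dec (A u w)
  arc? u w with w ≟ r
  ... | yes refl = no (root-no-in u)
  ... | no w≢r with in-neighbour w w≢r
  ... | p , p→w , only-p with u ≟ p
  ... | yes refl = yes p→w
  ... | no u≢p = no (u≢p ∘ only-p u)

  ancestor : ℕ → Fin n → Fin n
  ancestor zero z = z
  ancestor (suc k) z = parent (ancestor k z)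

  ancestor-+ : ∀ a b z → ancestor (a + b) z ≡ ancestor a (ancestor b z)
  ancestor-+ zero b z = refl
  ancestor-+ (suc a) b z = cong parent (ancestor-+ a b z)

  walk⇒ancestor : ∀ {x z k} → Walk A x z k → ancestor k z ≡ x
  walk⇒ancestor here = refl
  walk⇒ancestor (step a w) rewrite walk⇒ancestor w = arc⇒parent a

  -- Only the first vertex of a walk can be the root, as r has no in-arcs.
  walk-avoids-root : ∀ {x z L} → Walk A x z L → ∀ s → s < L → ancestor s z ≢ r
  walk-avoids-root {L = suc L} (step a rest) s s<1+L aˢz≡r with m≤n⇒m<n∨m≡n (s≤s⁻¹ s<1+L)
  ... | inj₁ s<L = walk-avoids-root rest s s<L aˢz≡r
  ... | inj₂ refl = root-no-in _ (subst (A _) (trans (sym (walk⇒ancestor rest)) aˢz≡r) a)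

  -- Every walk from r has length less than n: otherwise two of the ancestors
  -- z, parent z, ..., ancestor L z would coincide (pigeonhole), and then r
  -- would be reached strictly before step L.
  walk-length<n : ∀ {z L} → Walk A r z L → L < n
  walk-length<n {z} {L} w with L <? n
  ... | yes L<n = L<n
  ... | no L≮n with pigeonhole (s≤s (≮⇒≥ L≮n)) (λ t → ancestor (toℕ t) z)
  ... | i , j , i<j , aⁱ≡aʲ = ⊥-elim (walk-avoids-root w ((L ∸ t) + s) shorter reaches-root)
    where
    s = toℕ i
    t = toℕ j
    t≤L : t ≤ L
    t≤L = s≤s⁻¹ (toℕ<n j)
    shorter : (L ∸ t) + s < L
    shorter = subst ((L ∸ t) + s <_) (m∸n+n≡m t≤L) (+-monoʳ-< (L ∸ t) i<j)
    reaches-root : ancestor ((L ∸ t) + s) z ≡ r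
    reaches-root = begin
      ancestor ((L ∸ t) + s) z   ≡⟨ ancestor-+ (L ∸ t) s z ⟩
      ancestor (L ∸ t) (ancestor s z) ≡⟨ cong (ancestor (L ∸ t)) aⁱ≡aʲ ⟩
      ancestor (L ∸ t) (ancestor t z) ≡⟨ ancestor-+ (L ∸ t) t z ⟨
      ancestor ((L ∸ t) + t) z   ≡⟨ cong (λ q → ancestor q z) (m∸n+n≡m t≤L) ⟩
      ancestor L z               ≡⟨ walk⇒ancestor w ⟩
      r                          ∎
      where open ≡-Reasoning

  ancestor-fixed : ∀ {x} → parent x ≡ x → ∀ k → ancestor k x ≡ x
  ancestor-fixed px≡x zero = refl
  ancestor-fixed px≡x (suc k) rewrite ancestor-fixed px≡x k = px≡x

  -- B has no loops: a loop at x makes x its own ancestor at every distance,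
  -- in particular at the length of a walk from r, so x = r, which has no in-arc.
  no-loop : ∀ {x} → Star A r x → ¬ A x x
  no-loop {x} r⇝x x→x with star⇒walk r⇝x
  ... | k , w = root-no-in x (subst (A x) x≡r x→x)
    where
    x≡r : x ≡ r
    x≡r = trans (sym (ancestor-fixed (arc⇒parent x→x) k)) (walk⇒ancestor w)

  -- The invariant of the procedure: every remaining vertex is reachable from r in B[S].
  Rooted : VSet n → Set
  Rooted S = ∀ w → S w → Star (Induced A S) r w

  whole-rooted : Rooted FullSet
  whole-rooted w _ = Star-map (λ a → tt , tt , a) (proj₂ (proj₂ branching) w)

  -- If every leaf of B[S] has depth at most d, then so does every vertex of B[S]:
  -- from a deeper vertex keep descending to a child; this ends at a leaf
  -- (deeper than d, a contradiction) because walks from r are shorter than n.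
  depth≤leaf-depth : ∀ S d → (∀ w → IsLeaf A S w → ∀ dw → Walk (Induced A S) r w dw → dw ≤ d) →
                     ∀ {y D} → S y → Walk (Induced A S) r y D → D ≤ d
  depth≤leaf-depth S d leaves≤d {y} {D} Sy r⇝y =
    decidable-stable (D ≤? d) (descend n Sy r⇝y (m≤n+m n D))
    where
    descend : ∀ fuel {y D} → S y → Walk (Induced A S) r y D → n ≤ D + fuel → ¬ D ≤ d → ⊥
    descend zero {D = D} Sy r⇝y n≤D _ =
      <⇒≱ (walk-length<n (walk-map (proj₂ ∘ proj₂) r⇝y)) (subst (n ≤_) (+-identityʳ D) n≤D)
    descend (suc fuel) {y} {D} Sy r⇝y n≤D+fuel D≰d =
      ¬¬-excluded-middle {A = ∃ (Induced A S y)} λ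
        { (yes (c , y→c)) → descend fuel (proj₁ (proj₂ y→c)) (walk-snoc r⇝y y→c)
                               (subst (n ≤_) (+-suc D fuel) n≤D+fuel) (D≰d ∘ <⇒≤)
        ; (no childless) → D≰d (leaves≤d y (Sy , λ c y→c → childless (c , y→c)) D r⇝y) }

  module StepAnalysis (S : VSet n) (S? : ∀ w → Dec (S w)) (rooted : Rooted S) {S′ : VSet n}
    (v v′ : Fin n) (deepest : IsMaxDepthLeaf A r S v) (v′→v : Induced A S v′ v)
    (S′⇔ : ∀ w → S′ w ⇔ (S w × ¬ Star (Induced A S) v′ w)) where

    S′⇒S : ∀ {w} → S′ w → S w
    S′⇒S {w} = proj₁ ∘ proj₁ (S′⇔ w)

    S′⇒unreached : ∀ {w} → S′ w → ¬ Star (Induced A S) v′ w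
    S′⇒unreached {w} = proj₂ ∘ proj₁ (S′⇔ w)

    -- The out-tree at v′ is an out-star: a path v′ → x → y would give y depth
    -- depth(v) + 1, more than the deepest leaf v.
    out-tree-is-star : ∀ {w} → Star (Induced A S) v′ w → w ≡ v′ ⊎ A v′ w
    out-tree-is-star ε = inj₁ refl
    out-tree-is-star (v′→x ◅ ε) = inj₂ (proj₂ (proj₂ v′→x))
    out-tree-is-star (v′→x ◅ x→y ◅ _) with star⇒walk (rooted v′ (proj₁ v′→v))
    ... | k , r⇝v′ = ⊥-elim (1+n≰n (depth≤leaf-depth S (suc k) leaves≤depth-v
                                      (proj₁ (proj₂ x→y)) (walk-snoc (walk-snoc r⇝v′ v′→x) x→y)))
      where
      leaves≤depth-v : ∀ w → IsLeaf A S w → ∀ dw → Walk (Induced A S) r w dw → dw ≤ suc k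
      leaves≤depth-v w leaf dw = proj₂ deepest w leaf (suc k) dw (walk-snoc r⇝v′ v′→v)

    reached-from-v′? : ∀ w → S w → Dec (Star (Induced A S) v′ w)
    reached-from-v′? w Sw with w ≟ v′ | arc? v′ w
    ... | yes refl | _ = yes ε
    ... | no _ | yes v′→w = yes ((proj₁ v′→v , Sw , v′→w) ◅ ε)
    ... | no w≢v′ | no ¬v′→w = no ([ w≢v′ , ¬v′→w ] ∘ out-tree-is-star)

    S′? : ∀ w → Dec (S′ w)
    S′? w with S? w
    ... | no ¬Sw = no (¬Sw ∘ S′⇒S)
    ... | yes Sw with reached-from-v′? w Sw
    ... | yes v′⇝w = no (λ S′w → S′⇒unreached S′w v′⇝w)
    ... | no ¬v′⇝w = yes (proj₂ (S′⇔ w) (Sw , ¬v′⇝w))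

    -- ... and rooted: a walk from r avoiding the removed out-tree stays inside S′.
    rooted′ : Rooted S′
    rooted′ w S′w = restrict (rooted w (S′⇒S S′w)) (S′⇒unreached S′w)
      where
      restrict : ∀ {u w} → Star (Induced A S) u w → ¬ Star (Induced A S) v′ w → Star (Induced A S′) u w
      restrict ε _ = ε
      restrict {u} (_◅_ {j = x} u→x x⇝w) ¬v′⇝w =
        (keep (proj₁ u→x) (u→x ◅ x⇝w) , keep (proj₁ (proj₂ u→x)) x⇝w , proj₂ (proj₂ u→x))
          ◅ restrict x⇝w ¬v′⇝w
        where
        keep : ∀ {y} → S y → Star (Induced A S) y _ → S′ y
        keep {y} Sy y⇝w = proj₂ (S′⇔ y) (Sy , λ v′⇝y → ¬v′⇝w (v′⇝y ◅◅ y⇝w))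

    other-child? : ∀ w → Dec (w ≢ v × S w × A v′ w)
    other-child? w = ¬? (w ≟ v) ×-dec (S? w ×-dec arc? v′ w)

    other-children : List (Fin n)
    other-children = filter other-child? (allFin n)

    removed-star : OutStar
    removed-star = v′ , (v ∷⁺ other-children)

    satellite-in-S : ∀ {w} → w ∈ v ∷ other-children → S w
    satellite-in-S (here refl) = proj₁ (proj₂ v′→v)
    satellite-in-S (there m) = proj₁ (proj₂ (proj₂ (∈-filter⁻ other-child? {xs = allFin n} m)))

    removed-star-in-B : IsOutStarIn A removed-star
    removed-star-in-B w (here refl) = proj₂ (proj₂ v′→v)
    removed-star-in-B w (there m) = proj₂ (proj₂ (proj₂ (∈-filter⁻ other-child? {xs = allFin n} m)))

    -- Its vertices are distinct: B has no loop at v′, v is filtered out of the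
    -- other children, and allFin has no repetitions.
    removed-star-unique : Unique (starVerts removed-star)
    removed-star-unique =
      All.tabulate (λ m → centre≢satellite (removed-star-in-B _ m)) ∷
      All.tabulate (λ m v≡w → proj₁ (proj₂ (∈-filter⁻ other-child? {xs = allFin n} m)) (sym v≡w)) ∷
      filter⁺ other-child? (allFin⁺ n)
      where
      centre≢satellite : ∀ {w} → A v′ w → v′ ≢ w
      centre≢satellite v′→w refl = no-loop (Star-map (proj₂ ∘ proj₂) (rooted v′ (proj₁ v′→v))) v′→w

    star-vertex⇒removed : ∀ {w} → w ∈ starVerts removed-star → (S ∖ S′) w
    star-vertex⇒removed (here refl) = proj₁ v′→v , λ S′v′ → S′⇒unreached S′v′ ε
    star-vertex⇒removed (there m) =
      satellite-in-S m ,
      λ S′w → S′⇒unreached S′w ((proj₁ v′→v , satellite-in-S m , removed-star-in-B _ m) ◅ ε)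

    removed⇒star-vertex : ∀ {w} → (S ∖ S′) w → w ∈ starVerts removed-star
    removed⇒star-vertex {w} (Sw , ¬S′w) with reached-from-v′? w Sw
    ... | no ¬v′⇝w = ⊥-elim (¬S′w (proj₂ (S′⇔ w) (Sw , ¬v′⇝w)))
    ... | yes v′⇝w with out-tree-is-star v′⇝w
    ... | inj₁ refl = here refl
    ... | inj₂ v′→w with w ≟ v
    ... | yes refl = there (here refl)
    ... | no w≢v = there (there (∈-filter⁺ other-child? (∈-allFin w) (w≢v , Sw , v′→w)))

  open Galaxies A

  -- The stars removed along a run S ⇝ T form a spanning out-galaxy of S ∖ T:
  -- the first star spans S ∖ S′, the rest of the run S′ ∖ T, and T ⊆ S′.
  removed-galaxy : ∀ {S T} → (∀ w → Dec (S w)) → Rooted S → Star (Step A r) S T → SpanningOutGalaxy A (S ∖ T)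
  removed-galaxy S? rooted ε = galaxy-resp (λ w → ⊥-elim , λ (Sw , ¬Sw) → ¬Sw Sw) galaxy-∅
  removed-galaxy {S} {T} S? rooted (_◅_ {j = S′} (v , v′ , deepest , v′→v , S′⇔) run) =
    galaxy-resp split
      (galaxy-∷ removed-star removed-star-in-B removed-star-unique
        (λ w m (S′w , _) → proj₂ (star-vertex⇒removed m) S′w)
        (removed-galaxy S′? rooted′ run))
    where
    open StepAnalysis S S? rooted v v′ deepest v′→v S′⇔
    split : ∀ w → (w ∈ starVerts removed-star ⊎ (S′ ∖ T) w) ⇔ (S ∖ T) w
    split w = [ from-star , (λ (S′w , ¬Tw) → S′⇒S S′w , ¬Tw) ] , to
      where
      from-star : w ∈ starVerts removed-star → (S ∖ T) w
      from-star m with star-vertex⇒removed m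
      ... | Sw , ¬S′w = Sw , ¬S′w ∘ run-shrinks run w
      to : (S ∖ T) w → w ∈ starVerts removed-star ⊎ (S′ ∖ T) w
      to (Sw , ¬Tw) with S′? w
      ... | yes S′w = inj₂ (S′w , ¬Tw)
      ... | no ¬S′w = inj₁ (removed⇒star-vertex (Sw , ¬S′w))

proposition5p8 : ∀ {n : ℕ} (A : Digraph n) (r : Fin n) → IsOutBranching A r →
    (Winning A r → SpanningOutGalaxy A FullSet × BipartitePartition A FullSet) ×
    (Losing A r → SpanningOutGalaxy A (AllBut r) × BipartitePartition A (AllBut r))
proposition5p8 A r branching = winning⇒galaxy , losing⇒galaxy
  where
  open OutBranching A r branching
  open Galaxies A

  removed : ∀ {T} → Star (Step A r) FullSet T → SpanningOutGalaxy A (FullSet ∖ T)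
  removed = removed-galaxy (λ _ → yes tt) whole-rooted

  winning⇒galaxy : Winning A r → SpanningOutGalaxy A FullSet × BipartitePartition A FullSet
  winning⇒galaxy (S , run , empty) = galaxy , galaxy⇒bipartite galaxy
    where
    galaxy : SpanningOutGalaxy A FullSet
    galaxy = galaxy-resp (λ w → (λ _ → tt) , λ _ → tt , empty w) (removed run)

  losing⇒galaxy : Losing A r → SpanningOutGalaxy A (AllBut r) × BipartitePartition A (AllBut r)
  losing⇒galaxy (S , run , only-root) = galaxy , galaxy⇒bipartite galaxy
    where
    galaxy : SpanningOutGalaxy A (AllBut r)
    galaxy = galaxy-resp
      (λ w → (λ (_ , ¬Sw) w≡r → ¬Sw (proj₂ (only-root w) w≡r))
           , (λ w≢r → tt , w≢r ∘ proj₁ (only-root w)))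
      (removed run)
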